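{- Let $f,g:\mathbb N\to\mathbb N$ have finite range. Then $g$ belongs to the smallest locally closed monoid containing $f$ and all permutations of $\mathbb N$ if and only if $\kappa^g\sqsubseteq\kappa^f$.
   Context: A monoid of maps $\mathbb N\to\mathbb N$ is locally closed if it is closed in $\mathbb N^{\mathbb N}$ with the product of discrete topologies. For $f$ with finite range of size $n$, enumerate its kernel classes $C_1,\dots,C_n$ with nondecreasing sizes; $\kappa^f=(|C_1|,\dots,|C_n|)\in(\omega+1)^n$. For $a\in(\omega+1)^k$, $b\in(\omega+1)^n$: $a\sqsubseteq b$ iff $k\le n$ and there is a partition $\{A_1,\dots,A_k\}$ of $\{1,\dots,n\}$ into $k$ classes with $a_i\le\sum_{j\in A_i}b_j$ for all $1\le i\le k$. -}

module Defs where

open import Level using (0ℓ)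
open import Data.Nat using (ℕ; zero; suc; _<_) renaming (_+_ to _+ℕ_; _≤_ to _≤ℕ_)
open import Data.Fin using (Fin; _≟_) renaming (zero to fzero; suc to fsuc) renaming (_≤_ to _≤ᶠ_)
open import Data.List using (List)
open import Data.List.Membership.Propositional using (_∈_)
open import Data.Product using (Σ; ∃; _×_; _,_)
open import Data.Unit using (⊤)
open import Data.Empty using (⊥)
open import Relation.Nullary using (yes; no)
open import Relation.Binary.PropositionalEquality using (_≡_)
open import Function using (_∘_; id)

Map : Set
Map = ℕ → ℕ

FiniteRange : Map → Set
FiniteRange f = Σ (List ℕ) λ l → ∀ x → f x ∈ l

IsPermutation : Map → Set
IsPermutation π = Σ Map λ σ → (∀ x → σ (π x) ≡ x) × (∀ x → π (σ x) ≡ x)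

MapSet : Set₁
MapSet = Map → Set

IsMonoid : MapSet → Set
IsMonoid M = M id × (∀ {g h} → M g → M h → M (g ∘ h))

-- Closed in ℕ^ℕ (product of discrete topologies): every h that agrees on
-- each finite initial segment with some member of M is itself in M.
IsLocallyClosed : MapSet → Set
IsLocallyClosed M =
  ∀ h → (∀ n → Σ Map λ m → M m × (∀ x → x < n → m x ≡ h x)) → M h

InGeneratedClosedMonoid : Map → Map → Set₁
InGeneratedClosedMonoid f g =
  (M : MapSet) → IsMonoid M → IsLocallyClosed M → M f →
  (∀ π → IsPermutation π → M π) → M g

data ℕω : Set where
  fin : ℕ → ℕω
  ω   : ℕω

_≤ω_ : ℕω → ℕω → Set
fin m ≤ω fin n = m ≤ℕ n
fin m ≤ω ω     = ⊤
ω     ≤ω fin n = ⊥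
ω     ≤ω ω     = ⊤

_+ω_ : ℕω → ℕω → ℕω
fin m +ω fin n = fin (m +ℕ n)
fin m +ω ω     = ω
ω     +ω _     = ω

InjectiveFin : ∀ {n} → (Fin n → ℕ) → Set
InjectiveFin e = ∀ i j → e i ≡ e j → i ≡ j

HasSize : (ℕ → Set) → ℕω → Set
HasSize P (fin n) = Σ (Fin n → ℕ) λ e →
  InjectiveFin e × (∀ i → P (e i)) × (∀ x → P x → ∃ λ i → e i ≡ x)
HasSize P ω = ∀ n → Σ (Fin n → ℕ) λ e → InjectiveFin e × (∀ i → P (e i))

-- κ^f = (n , v): r enumerates the range of f without repetition, the kernel
-- classes C_i = f⁻¹(r i) have sizes v i, and these are nondecreasing.
IsKappa : Map → (n : ℕ) → (Fin n → ℕω) → Set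
IsKappa f n v = Σ (Fin n → ℕ) λ r →
  InjectiveFin r ×
  (∀ i → ∃ λ x → f x ≡ r i) ×
  (∀ x → ∃ λ i → f x ≡ r i) ×
  (∀ i → HasSize (λ x → f x ≡ r i) (v i)) ×
  (∀ i j → i ≤ᶠ j → v i ≤ω v j)

sumClass : ∀ {n k} → (Fin n → Fin k) → Fin k → (Fin n → ℕω) → ℕω
sumClass {zero}  p i b = fin 0
sumClass {suc n} p i b with p fzero ≟ i
... | yes _ = b fzero +ω sumClass (p ∘ fsuc) i (b ∘ fsuc)
... | no  _ = sumClass (p ∘ fsuc) i (b ∘ fsuc)

-- a ⊑ b: k ≤ n and a partition {A_1..A_k} of {1..n} into k (nonempty)
-- classes, given as a surjection p : Fin n → Fin k with A_i = p⁻¹(i),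
-- such that a_i ≤ Σ_{j∈A_i} b_j.
_⊑_ : ∀ {k n} → (Fin k → ℕω) → (Fin n → ℕω) → Set
_⊑_ {k} {n} a b = k ≤ℕ n × Σ (Fin n → Fin k) λ p →
  (∀ i → ∃ λ j → p j ≡ i) × (∀ i → a i ≤ω sumClass p i b)

module Submission where

-- (⇒) The maps h which, on every initial segment [0,N), are injective or of
-- the form α ∘ f ∘ β with β injective there, form a locally closed monoid
-- containing f and all permutations (SegmentwiseFactoring), so they contain g.
-- On a segment longer than the range of g, g is not injective, hence
-- g = α ∘ f ∘ β there; α induces a surjection p from f-classes onto g-classes,
-- and β injects (a large enough part of) each g-class i into the union of the
-- f-classes in p⁻¹(i).  Counting (union-bounded) gives κ^g_i ≤ Σ_{p j = i} κ^f_j.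
--
-- (⇐) Fix such an M and the partition p.  Some f-class w is infinite, so
-- f ∘ (permutation) can redirect any class into w; conjugating by
-- transpositions redirects any class into any other, and composing
-- redirections realises every idempotent self-map of the classes
-- (IdempotentDecomposition), in particular c ∘ p for a section c of p.  This
-- yields A ∈ M sending the value of f on class j to the value of g on class p j.
-- For each N a permutation π places the points below N into distinct points of
-- the matching blocks (union-family), so A ∘ f ∘ π ∈ M agrees with g on [0,N);
-- local closedness gives g ∈ M.

open import Defs
open import Data.Nat using (ℕ; zero; suc; _<_; _≤_; _+_; _∸_; _⊔_; z≤n)
import Data.Nat.Properties as ℕₚ
open import Data.Fin as Fin using (Fin; toℕ; fromℕ<; join; inject≤) renaming (zero to fzero; suc to fsuc)
import Data.Fin.Properties as Finₚ
open import Data.Product using (Σ; ∃; _×_; _,_; proj₁; proj₂)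
open import Data.Sum using (_⊎_; inj₁; inj₂)
import Data.Sum
open import Data.Sum.Properties using (inj₁-injective; inj₂-injective)
open import Data.Empty using (⊥; ⊥-elim)
open import Data.Unit using (tt)
open import Relation.Nullary using (¬_; Dec; yes; no)
open import Relation.Binary.Definitions using (DecidableEquality; tri<; tri≈; tri>)
open import Relation.Binary.PropositionalEquality
open import Function using (_∘_; id)

module Transposition {A : Set} (_≟_ : DecidableEquality A) where

  swap : A → A → A → A
  swap a b x with x ≟ a
  ... | yes _ = b
  ... | no _ with x ≟ b
  ...   | yes _ = a
  ...   | no _  = x

  swap-left : ∀ a b → swap a b a ≡ b
  swap-left a b with a ≟ a
  ... | yes _  = refl
  ... | no a≢a = ⊥-elim (a≢a refl)

  swap-right : ∀ a b → swap a b b ≡ a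
  swap-right a b with b ≟ a
  ... | yes b≡a = b≡a
  ... | no _ with b ≟ b
  ...   | yes _  = refl
  ...   | no b≢b = ⊥-elim (b≢b refl)

  swap-other : ∀ a b x → x ≢ a → x ≢ b → swap a b x ≡ x
  swap-other a b x x≢a x≢b with x ≟ a
  ... | yes x≡a = ⊥-elim (x≢a x≡a)
  ... | no _ with x ≟ b
  ...   | yes x≡b = ⊥-elim (x≢b x≡b)
  ...   | no _    = refl

  swap-involutive : ∀ a b x → swap a b (swap a b x) ≡ x
  swap-involutive a b x with x ≟ a
  ... | yes refl = swap-right x b
  ... | no x≢a with x ≟ b
  ...   | yes refl = swap-left a x
  ...   | no x≢b   = swap-other a b x x≢a x≢b

  swap-injective : ∀ a b x y → swap a b x ≡ swap a b y → x ≡ y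
  swap-injective a b x y eq =
    trans (sym (swap-involutive a b x)) (trans (cong (swap a b) eq) (swap-involutive a b y))

  redirect : A → A → A → A
  redirect a b x with x ≟ a
  ... | yes _ = b
  ... | no _  = x

  redirect-source : ∀ a b → redirect a b a ≡ b
  redirect-source a b with a ≟ a
  ... | yes _  = refl
  ... | no a≢a = ⊥-elim (a≢a refl)

  redirect-other : ∀ a b x → x ≢ a → redirect a b x ≡ x
  redirect-other a b x x≢a with x ≟ a
  ... | yes x≡a = ⊥-elim (x≢a x≡a)
  ... | no _    = refl

  redirect-conjugate : ∀ a b w x →
    swap b w (redirect (swap b w a) w (swap b w x)) ≡ redirect a b x
  redirect-conjugate a b w x with x ≟ a
  ... | yes refl = trans (cong (swap b w) (redirect-source (swap b w x) w)) (swap-right b w)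
  ... | no x≢a   = trans (cong (swap b w) (redirect-other _ w _ (x≢a ∘ swap-injective b w x a)))
                         (swap-involutive b w x)

module ℕ-Transposition = Transposition ℕₚ._≟_
module Fin-Transposition {n} = Transposition (Finₚ._≟_ {n})

id-isPermutation : IsPermutation id
id-isPermutation = id , (λ _ → refl) , (λ _ → refl)

swap-isPermutation : ∀ a b → IsPermutation (ℕ-Transposition.swap a b)
swap-isPermutation a b = swap a b , swap-involutive a b , swap-involutive a b
  where open ℕ-Transposition

∘-isPermutation : ∀ {π ρ} → IsPermutation π → IsPermutation ρ → IsPermutation (π ∘ ρ)
∘-isPermutation {π} {ρ} (π⁻¹ , π⁻¹π , ππ⁻¹) (ρ⁻¹ , ρ⁻¹ρ , ρρ⁻¹) =
  ρ⁻¹ ∘ π⁻¹ ,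
  (λ x → trans (cong ρ⁻¹ (π⁻¹π (ρ x))) (ρ⁻¹ρ x)) ,
  (λ x → trans (cong π (ρρ⁻¹ (π⁻¹ x))) (ππ⁻¹ x))

isPermutation-injective : ∀ {π} → IsPermutation π → ∀ x y → π x ≡ π y → x ≡ y
isPermutation-injective (π⁻¹ , π⁻¹π , _) x y eq = trans (sym (π⁻¹π x)) (trans (cong π⁻¹ eq) (π⁻¹π y))

-- Any two injective lists a, b of m naturals are related by a permutation of ℕ
-- mapping a l to b l: compose the extension for the tails with one transposition.
extend-to-permutation : ∀ m (a b : Fin m → ℕ) → InjectiveFin a → InjectiveFin b →
  Σ Map λ π → IsPermutation π × (∀ l → π (a l) ≡ b l)
extend-to-permutation zero a b _ _ = id , id-isPermutation , λ ()
extend-to-permutation (suc m) a b a-inj b-inj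
  with extend-to-permutation m (a ∘ fsuc) (b ∘ fsuc)
         (λ i j eq → Finₚ.suc-injective (a-inj _ _ eq)) (λ i j eq → Finₚ.suc-injective (b-inj _ _ eq))
... | π , π-perm , πa≡b = τ ∘ π , ∘-isPermutation (swap-isPermutation _ _) π-perm , maps
  where
  open ℕ-Transposition
  τ : Map
  τ = swap (b fzero) (π (a fzero))
  suc≢zero : ∀ {l : Fin m} → fsuc l ≢ fzero
  suc≢zero ()
  maps : ∀ l → τ (π (a l)) ≡ b l
  maps fzero    = swap-right (b fzero) (π (a fzero))
  maps (fsuc l) = trans (cong τ (πa≡b l)) (swap-other _ _ (b (fsuc l))
    (suc≢zero ∘ b-inj _ _)
    (λ eq → suc≢zero (a-inj _ _ (isPermutation-injective π-perm _ _ (trans (πa≡b l) eq)))))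

Family : (ℕ → Set) → ℕ → Set
Family P c = Σ (Fin c → ℕ) λ e → InjectiveFin e × (∀ a → P (e a))

-- InjectsInto P s: an injection of P into Fin s, i.e. a witness that |P| ≤ s.
-- It may depend on the membership proof; injectivity holds for all choices.
InjectsInto : (ℕ → Set) → ℕ → Set
InjectsInto P s = Σ ((x : ℕ) → P x → Fin s) λ ι → ∀ x y px py → ι x px ≡ ι y py → x ≡ y

module _ {P Q : ℕ → Set} where

  family-weaken : (∀ x → P x → Q x) → ∀ {c} → Family P c → Family Q c
  family-weaken P⊆Q (e , e-inj , eP) = e , e-inj , λ a → P⊆Q _ (eP a)

  injects-weaken : (∀ x → P x → Q x) → ∀ {s} → InjectsInto Q s → InjectsInto P s
  injects-weaken P⊆Q (ι , ι-inj) = (λ x px → ι x (P⊆Q x px)) , λ x y _ _ eq → ι-inj x y _ _ eq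

  family-⊎ : (∀ x → P x → Q x → ⊥) → ∀ {c d} → Family P c → Family Q d →
    Family (λ x → P x ⊎ Q x) (c + d)
  family-⊎ disjoint {c} {d} (e , e-inj , eP) (e′ , e′-inj , e′Q) =
    [e,e′] ∘ Fin.splitAt c , [e,e′]-injective , [e,e′]-in ∘ Fin.splitAt c
    where
    [e,e′] : Fin c ⊎ Fin d → ℕ
    [e,e′] (inj₁ a) = e a
    [e,e′] (inj₂ a) = e′ a
    [e,e′]-in : ∀ z → P ([e,e′] z) ⊎ Q ([e,e′] z)
    [e,e′]-in (inj₁ a) = inj₁ (eP a)
    [e,e′]-in (inj₂ a) = inj₂ (e′Q a)
    separate : ∀ z z′ → [e,e′] z ≡ [e,e′] z′ → z ≡ z′
    separate (inj₁ a) (inj₁ a′) eq = cong inj₁ (e-inj a a′ eq)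
    separate (inj₂ a) (inj₂ a′) eq = cong inj₂ (e′-inj a a′ eq)
    separate (inj₁ a) (inj₂ a′) eq = ⊥-elim (disjoint _ (eP a) (subst Q (sym eq) (e′Q a′)))
    separate (inj₂ a) (inj₁ a′) eq = ⊥-elim (disjoint _ (subst P (sym eq) (eP a′)) (e′Q a))
    [e,e′]-injective : InjectiveFin ([e,e′] ∘ Fin.splitAt c)
    [e,e′]-injective z z′ eq = begin
      z                          ≡⟨ Finₚ.join-splitAt c d z ⟨
      join c d (Fin.splitAt c z)  ≡⟨ cong (join c d) (separate (Fin.splitAt c z) (Fin.splitAt c z′) eq) ⟩
      join c d (Fin.splitAt c z′) ≡⟨ Finₚ.join-splitAt c d z′ ⟩
      z′                         ∎
      where open ≡-Reasoning

  -- Injections of P and Q combine to an injection of P ∪ Q (no disjointness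
  -- is needed, since the membership proof says which side x was counted in).
  injects-⊎ : ∀ {m s} → InjectsInto P m → InjectsInto Q s → InjectsInto (λ x → P x ⊎ Q x) (m + s)
  injects-⊎ {m} {s} (ι , ι-inj) (κ , κ-inj) = (λ x → join m s ∘ χ x) , χ-injective
    where
    χ : ∀ x → P x ⊎ Q x → Fin m ⊎ Fin s
    χ x (inj₁ px) = inj₁ (ι x px)
    χ x (inj₂ qx) = inj₂ (κ x qx)
    separate : ∀ x y u v → χ x u ≡ χ y v → x ≡ y
    separate x y (inj₁ px) (inj₁ py) eq = ι-inj x y px py (inj₁-injective eq)
    separate x y (inj₂ qx) (inj₂ qy) eq = κ-inj x y qx qy (inj₂-injective eq)
    separate x y (inj₁ px) (inj₂ qy) ()
    separate x y (inj₂ qx) (inj₁ py) ()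
    χ-injective : ∀ x y u v → join m s (χ x u) ≡ join m s (χ y v) → x ≡ y
    χ-injective x y u v eq = separate x y u v (begin
      χ x u                       ≡⟨ Finₚ.splitAt-join m s (χ x u) ⟨
      Fin.splitAt m (join m s (χ x u)) ≡⟨ cong (Fin.splitAt m) eq ⟩
      Fin.splitAt m (join m s (χ y v)) ≡⟨ Finₚ.splitAt-join m s (χ y v) ⟩
      χ y v                       ∎)
      where open ≡-Reasoning

family-≤-bound : ∀ {P c s} → Family P c → InjectsInto P s → c ≤ s
family-≤-bound (e , e-inj , eP) (ι , ι-inj) =
  Finₚ.injective⇒≤ {f = λ a → ι (e a) (eP a)} λ eq → e-inj _ _ (ι-inj _ _ _ _ eq)

family-shrink : ∀ {P c d} → d ≤ c → Family P c → Family P d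
family-shrink d≤c (e , e-inj , eP) =
  e ∘ (λ a → inject≤ a d≤c) , (λ a a′ eq → Finₚ.inject≤-injective d≤c d≤c a a′ (e-inj _ _ eq)) , eP ∘ _

finite-family : ∀ {P m} → HasSize P (fin m) → Family P m
finite-family (e , e-inj , eP , _) = e , e-inj , eP

finite-injects : ∀ {P m} → HasSize P (fin m) → InjectsInto P m
finite-injects (e , _ , _ , onto) =
  (λ x px → proj₁ (onto x px)) ,
  λ x y px py eq → trans (sym (proj₂ (onto x px))) (trans (cong e eq) (proj₂ (onto y py)))

+ω-fin : ∀ x y {s} → x +ω y ≡ fin s → Σ ℕ λ a → Σ ℕ λ c → x ≡ fin a × y ≡ fin c × s ≡ a + c
+ω-fin (fin a) (fin c) refl = a , c , refl , refl , refl

+ω-ω : ∀ x y → x +ω y ≡ ω → x ≡ ω ⊎ y ≡ ω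
+ω-ω (fin a) ω     _  = inj₂ refl
+ω-ω ω       y     _  = inj₁ refl
+ω-ω (fin a) (fin c) ()

Union : ∀ {n k} → (Fin n → Fin k) → Fin k → (Fin n → ℕ → Set) → ℕ → Set
Union p i C x = ∃ λ j → p j ≡ i × C j x

module _ {n k} (p : Fin (suc n) → Fin k) (i : Fin k) (C : Fin (suc n) → ℕ → Set) where

  union-split : ∀ x → Union p i C x → (p fzero ≡ i × C fzero x) ⊎ Union (p ∘ fsuc) i (C ∘ fsuc) x
  union-split x (fzero  , pj≡i , cj) = inj₁ (pj≡i , cj)
  union-split x (fsuc j , pj≡i , cj) = inj₂ (j , pj≡i , cj)

  union-tail : ∀ x → Union (p ∘ fsuc) i (C ∘ fsuc) x → Union p i C x
  union-tail x (j , pj≡i , cj) = fsuc j , pj≡i , cj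

  union-tail⁻¹ : p fzero ≢ i → ∀ x → Union p i C x → Union (p ∘ fsuc) i (C ∘ fsuc) x
  union-tail⁻¹ p0≢i x u with union-split x u
  ... | inj₁ (p0≡i , _) = ⊥-elim (p0≢i p0≡i)
  ... | inj₂ u′         = u′

-- Like the following lemmas on sumClass,
-- this splits on p fzero ≟ i exactly as sumClass does, so the sum reduces.
union-bounded : ∀ {n k} (p : Fin n → Fin k) i (b : Fin n → ℕω) (C : Fin n → ℕ → Set) →
  (∀ j → HasSize (C j) (b j)) → ∀ {s} → sumClass p i b ≡ fin s → InjectsInto (Union p i C) s
union-bounded {zero} p i b C sizes refl = (λ { x (() , _) }) , λ { x y (() , _) }
union-bounded {suc n} p i b C sizes sum≡s with p fzero Fin.≟ i
... | no p0≢i = injects-weaken (union-tail⁻¹ p i C p0≢i)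
                  (union-bounded (p ∘ fsuc) i (b ∘ fsuc) (C ∘ fsuc) (sizes ∘ fsuc) sum≡s)
... | yes _ with +ω-fin (b fzero) _ sum≡s
...   | a , c , b0≡a , rest≡c , refl = injects-weaken (λ x → Data.Sum.map₁ proj₂ ∘ union-split p i C x)
          (injects-⊎ (finite-injects (subst (HasSize (C fzero)) b0≡a (sizes fzero)))
                     (union-bounded (p ∘ fsuc) i (b ∘ fsuc) (C ∘ fsuc) (sizes ∘ fsuc) rest≡c))

Disjoint : ∀ {n} → (Fin n → ℕ → Set) → Set
Disjoint C = ∀ j j′ x → C j x → C j′ x → j ≡ j′

disjoint-tail : ∀ {n} {C : Fin (suc n) → ℕ → Set} → Disjoint C → Disjoint (C ∘ fsuc)
disjoint-tail disjoint j j′ x u v = Finₚ.suc-injective (disjoint _ _ x u v)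

union-family : ∀ {n k} (p : Fin n → Fin k) i (b : Fin n → ℕω) (C : Fin n → ℕ → Set) →
  Disjoint C → (∀ j → HasSize (C j) (b j)) →
  ∀ c → fin c ≤ω sumClass p i b → Family (Union p i C) c
union-family {zero} p i b C disjoint sizes zero c≤0 = (λ ()) , (λ ()) , (λ ())
union-family {suc n} p i b C disjoint sizes c c≤sum with p fzero Fin.≟ i
... | no _     = family-weaken (union-tail p i C)
    (union-family (p ∘ fsuc) i (b ∘ fsuc) (C ∘ fsuc) (disjoint-tail disjoint) (sizes ∘ fsuc) c c≤sum)
... | yes p0≡i = head-and-tail (b fzero) (sizes fzero) c≤sum
  where
  head-or-tail : ∀ x → C fzero x ⊎ Union (p ∘ fsuc) i (C ∘ fsuc) x → Union p i C x
  head-or-tail x (inj₁ c0) = fzero , p0≡i , c0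
  head-or-tail x (inj₂ u)  = union-tail p i C x u
  head-apart : ∀ x → C fzero x → Union (p ∘ fsuc) i (C ∘ fsuc) x → ⊥
  head-apart x c0 (j , _ , cj) with disjoint fzero (fsuc j) x c0 cj
  ... | ()
  drop-head : ∀ {m} S → fin c ≤ω (fin m +ω S) → fin (c ∸ m) ≤ω S
  drop-head {m} (fin s) c≤m+s = ℕₚ.m≤n+o⇒m∸n≤o c m c≤m+s
  drop-head     ω       _     = tt
  head-and-tail : ∀ b0 → HasSize (C fzero) b0 → fin c ≤ω (b0 +ω sumClass (p ∘ fsuc) i (b ∘ fsuc)) →
    Family (Union p i C) c
  head-and-tail ω       infinite _        = family-weaken (λ x → head-or-tail x ∘ inj₁) (infinite c)
  head-and-tail (fin m) finite   c≤m+rest = family-shrink {Union p i C} (ℕₚ.m≤n+m∸n c m)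
    (family-weaken head-or-tail (family-⊎ head-apart (finite-family finite)
      (union-family (p ∘ fsuc) i (b ∘ fsuc) (C ∘ fsuc) (disjoint-tail disjoint) (sizes ∘ fsuc)
        (c ∸ m) (drop-head _ c≤m+rest))))

∃-tail : ∀ {n} {P : Fin (suc n) → Set} → ∃ (P ∘ fsuc) → ∃ P
∃-tail (j , pj) = fsuc j , pj

sumClass-ω : ∀ {n k} (p : Fin n → Fin k) i (b : Fin n → ℕω) → sumClass p i b ≡ ω → ∃ λ j → b j ≡ ω
sumClass-ω {zero}  p i b ()
sumClass-ω {suc n} p i b sum≡ω with p fzero Fin.≟ i
... | no _ = ∃-tail (sumClass-ω (p ∘ fsuc) i (b ∘ fsuc) sum≡ω)
... | yes _ with +ω-ω (b fzero) _ sum≡ω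
...   | inj₁ b0≡ω   = fzero , b0≡ω
...   | inj₂ rest≡ω = ∃-tail (sumClass-ω (p ∘ fsuc) i (b ∘ fsuc) rest≡ω)

finiteTotal : ∀ {n} → (Fin n → ℕω) → ℕ
finiteTotal {zero}  b = 0
finiteTotal {suc n} b = finitePart (b fzero) + finiteTotal (b ∘ fsuc)
  where
  finitePart : ℕω → ℕ
  finitePart (fin m) = m
  finitePart ω       = 0

sumClass-≤-total : ∀ {n k} (p : Fin n → Fin k) i (b : Fin n → ℕω) {s} →
  sumClass p i b ≡ fin s → s ≤ finiteTotal b
sumClass-≤-total {zero}  p i b refl = z≤n
sumClass-≤-total {suc n} p i b sum≡s with p fzero Fin.≟ i
... | no _ = ℕₚ.≤-trans (sumClass-≤-total (p ∘ fsuc) i (b ∘ fsuc) sum≡s) (ℕₚ.m≤n+m _ _)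
... | yes _ with b fzero | +ω-fin (b fzero) _ sum≡s
...   | .(fin a) | a , c , refl , rest≡c , refl =
  ℕₚ.+-monoʳ-≤ a (sumClass-≤-total (p ∘ fsuc) i (b ∘ fsuc) rest≡c)

bound-fin : ∀ m (h : Fin m → ℕ) → Σ ℕ λ B → ∀ a → h a < B
bound-fin zero    h = 0 , λ ()
bound-fin (suc m) h with bound-fin m (h ∘ fsuc)
... | B , h<B = suc (h fzero) ⊔ B , λ
  { fzero    → ℕₚ.m≤m⊔n (suc (h fzero)) B
  ; (fsuc a) → ℕₚ.≤-trans (h<B a) (ℕₚ.m≤n⊔m (suc (h fzero)) B) }

bound-below : ∀ N (h : Map) → Σ ℕ λ B → ∀ x → x < N → h x < B
bound-below N h with bound-fin N (h ∘ toℕ)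
... | B , h<B = B , λ x x<N → subst (λ z → h z < B) (Finₚ.toℕ-fromℕ< x<N) (h<B (fromℕ< x<N))

module Kappa {f : Map} {n : ℕ} {v : Fin n → ℕω} (κ : IsKappa f n v) where

  value : Fin n → ℕ
  value = proj₁ κ

  value-injective : InjectiveFin value
  value-injective = proj₁ (proj₂ κ)

  Class : Fin n → ℕ → Set
  Class i x = f x ≡ value i

  representative : ∀ i → ∃ (Class i)
  representative = proj₁ (proj₂ (proj₂ κ))

  classOf : ∀ x → ∃ λ i → Class i x
  classOf = proj₁ (proj₂ (proj₂ (proj₂ κ)))

  classSize : ∀ i → HasSize (Class i) (v i)
  classSize = proj₁ (proj₂ (proj₂ (proj₂ (proj₂ κ))))

  classes-disjoint : Disjoint Class
  classes-disjoint i i′ x x∈i x∈i′ = value-injective i i′ (trans (sym x∈i) x∈i′)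

InjectiveBelow : ℕ → Map → Set
InjectiveBelow N h = ∀ x y → x < N → y < N → h x ≡ h y → x ≡ y

FactorsBelow : Map → ℕ → Map → Set
FactorsBelow f N h = Σ Map λ α → Σ Map λ β → InjectiveBelow N β × (∀ x → x < N → h x ≡ α (f (β x)))

injectiveBelow-∘ : ∀ {N B h₁ h₂} → (∀ x → x < N → h₂ x < B) →
  InjectiveBelow B h₁ → InjectiveBelow N h₂ → InjectiveBelow N (h₁ ∘ h₂)
injectiveBelow-∘ h₂<B h₁-inj h₂-inj x y x<N y<N eq =
  h₂-inj x y x<N y<N (h₁-inj _ _ (h₂<B x x<N) (h₂<B y y<N) eq)

module SegmentwiseFactoring (f : Map) where

  Tame : MapSet
  Tame h = ∀ N → InjectiveBelow N h ⊎ FactorsBelow f N h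

  tame-monoid : IsMonoid Tame
  tame-monoid = (λ N → inj₁ λ x y _ _ eq → eq) , tame-∘
    where
    -- If h₂ factors on [0,N), so does h₁ ∘ h₂.  If h₂ is injective there with
    -- values below B, then h₁ ∘ h₂ inherits the behaviour of h₁ on [0,B).
    tame-∘ : ∀ {h₁ h₂} → Tame h₁ → Tame h₂ → Tame (h₁ ∘ h₂)
    tame-∘ {h₁} {h₂} tame₁ tame₂ N with tame₂ N
    ... | inj₂ (α , β , β-inj , h₂≡αfβ) = inj₂ (h₁ ∘ α , β , β-inj , λ x x<N → cong h₁ (h₂≡αfβ x x<N))
    ... | inj₁ h₂-inj with bound-below N h₂
    ...   | B , h₂<B with tame₁ B
    ...     | inj₁ h₁-inj = inj₁ (injectiveBelow-∘ h₂<B h₁-inj h₂-inj)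
    ...     | inj₂ (α , β , β-inj , h₁≡αfβ) =
                inj₂ (α , β ∘ h₂ , injectiveBelow-∘ h₂<B β-inj h₂-inj , λ x x<N → h₁≡αfβ (h₂ x) (h₂<B x x<N))

  tame-closed : IsLocallyClosed Tame
  tame-closed h approximations N with approximations N
  ... | m , tame-m , m≡h with tame-m N
  ...   | inj₁ m-inj = inj₁ λ x y x<N y<N eq →
            m-inj x y x<N y<N (trans (m≡h x x<N) (trans eq (sym (m≡h y y<N))))
  ...   | inj₂ (α , β , β-inj , m≡αfβ) = inj₂ (α , β , β-inj , λ x x<N → trans (sym (m≡h x x<N)) (m≡αfβ x x<N))

  tame-f : Tame f
  tame-f N = inj₂ (id , id , (λ x y _ _ eq → eq) , λ x _ → refl)

  tame-permutation : ∀ π → IsPermutation π → Tame π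
  tame-permutation π π-perm N = inj₁ λ x y _ _ → isPermutation-injective π-perm x y

  generated⇒tame : ∀ {g} → InGeneratedClosedMonoid f g → Tame g
  generated⇒tame generated = generated Tame tame-monoid tame-closed tame-f tame-permutation

-- The index of t among the values of r, or a default if t is not a value.
indexOf : ∀ {k} (r : Fin k → ℕ) → Fin k → ℕ → Fin k
indexOf r default t with Finₚ.any? (λ i → r i ℕₚ.≟ t)
... | yes (i , _) = i
... | no _        = default

indexOf-spec : ∀ {k} {r : Fin k → ℕ} → InjectiveFin r → ∀ default {t} i → r i ≡ t → indexOf r default t ≡ i
indexOf-spec {r = r} r-inj default {t} i ri≡t with Finₚ.any? (λ i → r i ℕₚ.≟ t)
... | yes (i′ , ri′≡t) = r-inj i′ i (trans ri′≡t (sym ri≡t))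
... | no  no-index    = ⊥-elim (no-index (i , ri≡t))

truncatedLength : ℕ → ℕω → ℕ
truncatedLength T (fin c) = c
truncatedLength T ω       = suc T

truncated-family : ∀ {P} T v → HasSize P v → Family P (truncatedLength T v)
truncated-family T (fin c) size = finite-family size
truncated-family T ω       size = size (suc T)

truncated-bound : ∀ T v {s} → truncatedLength T v ≤ s → s ≤ T → v ≤ω fin s
truncated-bound T (fin c) c≤s  _   = c≤s
truncated-bound T ω       T<s s≤T = ⊥-elim (ℕₚ.n≮n T (ℕₚ.<-≤-trans T<s s≤T))

≤ω-ω : ∀ v → v ≤ω ω
≤ω-ω (fin _) = tt
≤ω-ω ω       = tt

module Forward {f g : Map} {n k} {κf : Fin n → ℕω} {κg : Fin k → ℕω}
  (kf : IsKappa f n κf) (kg : IsKappa g k κg) where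

  module F = Kappa kf
  module G = Kappa kg
  open SegmentwiseFactoring f

  -- Any finite block sum of κf is at most T.
  T : ℕ
  T = finiteTotal κf

  witness : ∀ i → Family (G.Class i) (truncatedLength T (κg i))
  witness i = truncated-family T (κg i) (G.classSize i)

  -- A segment [0, N) longer than k and containing, for every g-class, its
  -- representative and its witness family.
  classBound : Fin k → ℕ
  classBound i = proj₁ (bound-fin _ (proj₁ (witness i))) ⊔ suc (proj₁ (G.representative i))

  N : ℕ
  N = proj₁ (bound-fin k classBound) ⊔ suc k

  below-N : ∀ i {x} → x < classBound i → x < N
  below-N i x<bound = ℕₚ.<-trans x<bound
    (ℕₚ.≤-trans (proj₂ (bound-fin k classBound) i) (ℕₚ.m≤m⊔n _ _))

  representative<N : ∀ i → proj₁ (G.representative i) < N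
  representative<N i = below-N i (ℕₚ.m≤n⊔m _ _)

  witness<N : ∀ i a → proj₁ (witness i) a < N
  witness<N i a = below-N i (ℕₚ.≤-trans (proj₂ (bound-fin _ (proj₁ (witness i))) a) (ℕₚ.m≤m⊔n _ _))

  -- g takes only k values, so it is not injective on [0, N) (pigeonhole).
  not-injective : ¬ InjectiveBelow N g
  not-injective g-inj with Finₚ.pigeonhole (ℕₚ.n<1+n k) (λ a → proj₁ (G.classOf (toℕ a)))
  ... | a , a′ , a<a′ , same-class = Finₚ.<⇒≢ a<a′ (Finₚ.toℕ-injective
        (g-inj _ _ (below a) (below a′) (trans (proj₂ (G.classOf (toℕ a)))
          (trans (cong G.value same-class) (sym (proj₂ (G.classOf (toℕ a′))))))))
    where
    below : ∀ (a : Fin (suc k)) → toℕ a < N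
    below a = ℕₚ.<-≤-trans (Finₚ.toℕ<n a) (ℕₚ.m≤n⊔m _ (suc k))

  -- A factorisation g = α ∘ f ∘ β on [0, N) yields the partition witnessing
  -- κ^g ⊑ κ^f: the f-class j goes to the g-class of the value α (value of j).
  module FromFactorisation (α β : Map) (β-inj : InjectiveBelow N β)
    (g≡αfβ : ∀ x → x < N → g x ≡ α (f (β x))) where

    -- Classes whose value is not a g-value go to the class of g 0 (any will do).
    p : Fin n → Fin k
    p j = indexOf G.value (proj₁ (G.classOf 0)) (α (F.value j))

    p-spec : ∀ {x} → x < N → ∀ i j → G.Class i x → F.Class j (β x) → p j ≡ i
    p-spec {x} x<N i j x∈i βx∈j =
      indexOf-spec G.value-injective _ i (trans (sym x∈i) (trans (g≡αfβ x x<N) (cong α βx∈j)))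

    p-surjective : ∀ i → ∃ λ j → p j ≡ i
    p-surjective i = j , p-spec (representative<N i) i j x∈i βx∈j
      where
      x∈i = proj₂ (G.representative i)
      j = proj₁ (F.classOf (β (proj₁ (G.representative i))))
      βx∈j = proj₂ (F.classOf (β (proj₁ (G.representative i))))

    -- A surjection Fin n → Fin k has an injective section.
    k≤n : k ≤ n
    k≤n = Finₚ.injective⇒≤ {f = λ i → proj₁ (p-surjective i)} λ {i} {i′} eq →
      trans (sym (proj₂ (p-surjective i))) (trans (cong p eq) (proj₂ (p-surjective i′)))

    witness-image : ∀ i → Family (Union p i F.Class) (truncatedLength T (κg i))
    witness-image i with witness i | witness<N i
    ... | e , e-inj , e∈i | e<N =
      β ∘ e ,
      (λ a a′ eq → e-inj a a′ (β-inj _ _ (e<N a) (e<N a′) eq)) ,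
      λ a → proj₁ (F.classOf (β (e a))) ,
            p-spec (e<N a) i _ (e∈i a) (proj₂ (F.classOf (β (e a)))) ,
            proj₂ (F.classOf (β (e a)))

    -- If the block sum is a finite s, the union over the block has at most s
    -- points, so it bounds the witness image; as s ≤ T, κg i is finite too.
    block-size : ∀ i → κg i ≤ω sumClass p i κf
    block-size i with sumClass p i κf in sum≡
    ... | ω     = ≤ω-ω (κg i)
    ... | fin s = truncated-bound T (κg i)
                    (family-≤-bound (witness-image i) (union-bounded p i κf F.Class F.classSize sum≡))
                    (sumClass-≤-total p i κf sum≡)

    refinement : κg ⊑ κf
    refinement = k≤n , p , p-surjective , block-size

  forward : InGeneratedClosedMonoid f g → κg ⊑ κf
  forward generated with generated⇒tame generated N
  ... | inj₁ g-inj                  = ⊥-elim (not-injective g-inj)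
  ... | inj₂ (α , β , β-inj , g≡αfβ) = FromFactorisation.refinement α β β-inj g≡αfβ

-- An idempotent self-map ρ of Fin n is the composite of the redirections
-- a ↦ ρ a for a = 0, …, n-1; partial t is the composite of the first t of them.
module IdempotentDecomposition {n} (ρ : Fin n → Fin n) (idempotent : ∀ j → ρ (ρ j) ≡ ρ j) where
  open Fin-Transposition

  partial : ℕ → Fin n → Fin n
  partial t j with toℕ j ℕₚ.<? t
  ... | yes _ = ρ j
  ... | no _  = j

  partial-below : ∀ {t j} → toℕ j < t → partial t j ≡ ρ j
  partial-below {t} {j} j<t with toℕ j ℕₚ.<? t
  ... | yes _  = refl
  ... | no j≮t = ⊥-elim (j≮t j<t)

  partial-above : ∀ {t j} → ¬ toℕ j < t → partial t j ≡ j
  partial-above {t} {j} j≮t with toℕ j ℕₚ.<? t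
  ... | yes j<t = ⊥-elim (j≮t j<t)
  ... | no _    = refl

  redirect-fixes-image : ∀ a j → redirect a (ρ a) (ρ j) ≡ ρ j
  redirect-fixes-image a j = fixes (ρ j Finₚ.≟ a)
    where
    open ≡-Reasoning
    fixes : Dec (ρ j ≡ a) → redirect a (ρ a) (ρ j) ≡ ρ j
    fixes (no ρj≢a)  = redirect-other a (ρ a) (ρ j) ρj≢a
    fixes (yes ρj≡a) = begin
      redirect a (ρ a) (ρ j) ≡⟨ cong (redirect a (ρ a)) ρj≡a ⟩
      redirect a (ρ a) a     ≡⟨ redirect-source a (ρ a) ⟩
      ρ a                    ≡⟨ cong ρ ρj≡a ⟨
      ρ (ρ j)                ≡⟨ idempotent j ⟩
      ρ j                    ∎

  partial-step : ∀ {t} (t<n : t < n) j → redirect (fromℕ< t<n) (ρ (fromℕ< t<n)) (partial t j) ≡ partial (suc t) j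
  partial-step {t} t<n j with ℕₚ.<-cmp (toℕ j) t
  ... | tri< j<t _ _ = begin
    redirect a (ρ a) (partial t j) ≡⟨ cong (redirect a (ρ a)) (partial-below j<t) ⟩
    redirect a (ρ a) (ρ j)         ≡⟨ redirect-fixes-image a j ⟩
    ρ j                            ≡⟨ partial-below (ℕₚ.m<n⇒m<1+n j<t) ⟨
    partial (suc t) j              ∎
    where open ≡-Reasoning; a = fromℕ< t<n
  ... | tri≈ _ refl _ = begin
    redirect a (ρ a) (partial t j) ≡⟨ cong (redirect a (ρ a)) (partial-above (ℕₚ.n≮n (toℕ j))) ⟩
    redirect a (ρ a) j             ≡⟨ cong (redirect a (ρ a)) j≡a ⟩
    redirect a (ρ a) a             ≡⟨ redirect-source a (ρ a) ⟩
    ρ a                            ≡⟨ cong ρ j≡a ⟨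
    ρ j                            ≡⟨ partial-below (ℕₚ.n<1+n (toℕ j)) ⟨
    partial (suc t) j              ∎
    where
    open ≡-Reasoning
    a = fromℕ< t<n
    j≡a : j ≡ a
    j≡a = sym (Finₚ.fromℕ<-toℕ j t<n)
  ... | tri> _ _ t<j = begin
    redirect a (ρ a) (partial t j) ≡⟨ cong (redirect a (ρ a)) (partial-above (ℕₚ.<⇒≯ t<j)) ⟩
    redirect a (ρ a) j             ≡⟨ redirect-other a (ρ a) j j≢a ⟩
    j                              ≡⟨ partial-above (ℕₚ.<⇒≱ t<j ∘ ℕₚ.≤-pred) ⟨
    partial (suc t) j              ∎
    where
    open ≡-Reasoning
    a = fromℕ< t<n
    j≢a : j ≢ a
    j≢a j≡a = ℕₚ.<-irrefl (trans (sym (Finₚ.toℕ-fromℕ< t<n)) (sym (cong toℕ j≡a))) t<j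

module Backward {f g : Map} {n k} {κf : Fin n → ℕω} {κg : Fin k → ℕω}
  (kf : IsKappa f n κf) (kg : IsKappa g k κg) (refinement : κg ⊑ κf)
  (M : MapSet) (M-monoid : IsMonoid M) (M-closed : IsLocallyClosed M) (M-f : M f)
  (M-permutation : ∀ π → IsPermutation π → M π) where

  module F = Kappa kf
  module G = Kappa kg
  open Fin-Transposition

  p : Fin n → Fin k
  p = proj₁ (proj₂ refinement)

  p-surjective : ∀ i → ∃ λ j → p j ≡ i
  p-surjective = proj₁ (proj₂ (proj₂ refinement))

  block-size : ∀ i → κg i ≤ω sumClass p i κf
  block-size = proj₂ (proj₂ (proj₂ refinement))

  M-∘ : ∀ {h₁ h₂} → M h₁ → M h₂ → M (h₁ ∘ h₂)
  M-∘ = proj₂ M-monoid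

  Realised : (Fin n → Fin n) → Set
  Realised ρ = Σ Map λ A → M A × (∀ j → A (F.value j) ≡ F.value (ρ j))

  realised-id : Realised id
  realised-id = id , proj₁ M-monoid , λ _ → refl

  realised-∘ : ∀ {ρ ρ′} → Realised ρ → Realised ρ′ → Realised (ρ ∘ ρ′)
  realised-∘ {ρ} {ρ′} (A , A∈M , A-acts) (A′ , A′∈M , A′-acts) =
    A ∘ A′ , M-∘ A∈M A′∈M , λ j → trans (cong A (A′-acts j)) (A-acts (ρ′ j))

  realised-ext : ∀ {ρ ρ′} → (∀ j → ρ j ≡ ρ′ j) → Realised ρ → Realised ρ′
  realised-ext ρ≗ρ′ (A , A∈M , A-acts) = A , A∈M , λ j → trans (A-acts j) (cong F.value (ρ≗ρ′ j))

  -- ρ is realised as soon as there are distinct points pt j in the classes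
  -- ρ j: use f ∘ τ for a permutation τ moving the value of class j to pt j.
  realised-by-points : ∀ ρ (pt : Fin n → ℕ) → InjectiveFin pt → (∀ j → F.Class (ρ j) (pt j)) → Realised ρ
  realised-by-points ρ pt pt-inj pt∈ρ with extend-to-permutation n F.value pt F.value-injective pt-inj
  ... | τ , τ-perm , τ-moves = f ∘ τ , M-∘ M-f (M-permutation τ τ-perm) , λ j → trans (cong f (τ-moves j)) (pt∈ρ j)

  rep : Fin n → ℕ
  rep j = proj₁ (F.representative j)

  rep-injective : InjectiveFin rep
  rep-injective j j′ eq = F.classes-disjoint j j′ (rep j) (proj₂ (F.representative j))
    (subst (F.Class j′) (sym eq) (proj₂ (F.representative j′)))

  realised-swap : ∀ a b → Realised (swap a b)
  realised-swap a b = realised-by-points (swap a b) (rep ∘ swap a b)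
    (λ j j′ eq → swap-injective a b j j′ (rep-injective _ _ eq)) (λ j → proj₂ (F.representative (swap a b j)))

  -- Since ℕ is covered by the finitely many f-classes, one of them is infinite.
  infinite-class : ∃ λ w → κf w ≡ ω
  infinite-class with sumClass {k = 1} (λ _ → fzero) fzero κf in sum≡
  ... | ω     = sumClass-ω (λ _ → fzero) fzero κf sum≡
  ... | fin s = ⊥-elim (ℕₚ.n≮n s (family-≤-bound everything
                 (union-bounded (λ _ → fzero) fzero κf F.Class F.classSize sum≡)))
    where
    everything : Family (Union (λ _ → fzero) fzero F.Class) (suc s)
    everything = toℕ , (λ _ _ → Finₚ.toℕ-injective) , λ a → proj₁ (F.classOf (toℕ a)) , refl , proj₂ (F.classOf (toℕ a))

  w : Fin n
  w = proj₁ infinite-class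

  second : Σ ℕ λ u → u ≢ rep w × F.Class w u
  second with subst (HasSize (F.Class w)) (proj₂ infinite-class) (F.classSize w) 2
  ... | e , e-inj , e∈w with e fzero ℕₚ.≟ rep w
  ...   | no  e0≢rep = e fzero , e0≢rep , e∈w fzero
  ...   | yes e0≡rep = e (fsuc fzero) , (λ e1≡rep → 0≢1 (e-inj _ _ (trans e0≡rep (sym e1≡rep)))) , e∈w (fsuc fzero)
    where
    0≢1 : fzero ≢ fsuc fzero
    0≢1 ()

  -- Redirecting any class into w is realised by the points rep j, except
  -- that a is sent to the second point of w.
  realised-redirect-w : ∀ a → Realised (redirect a w)
  realised-redirect-w a = realised-by-points (redirect a w) pt pt-injective pt∈
    where
    u = proj₁ second
    pt : Fin n → ℕ
    pt j with j Finₚ.≟ a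
    ... | yes _ = u
    ... | no _  = rep j
    pt∈ : ∀ j → F.Class (redirect a w j) (pt j)
    pt∈ j with j Finₚ.≟ a
    ... | yes _ = proj₂ (proj₂ second)
    ... | no _  = proj₂ (F.representative j)
    u≢rep : ∀ j → u ≢ rep j
    u≢rep j u≡rep with F.classes-disjoint w j u (proj₂ (proj₂ second)) (subst (F.Class j) (sym u≡rep) (proj₂ (F.representative j)))
    ... | refl = proj₁ (proj₂ second) u≡rep
    pt-injective : InjectiveFin pt
    pt-injective j j′ eq with j Finₚ.≟ a | j′ Finₚ.≟ a
    ... | yes j≡a | yes j′≡a = trans j≡a (sym j′≡a)
    ... | no _    | no _     = rep-injective j j′ eq
    ... | yes _   | no _     = ⊥-elim (u≢rep j′ eq)
    ... | no _    | yes _    = ⊥-elim (u≢rep j (sym eq))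

  -- Conjugating by a transposition, every redirection is realised.
  realised-redirect : ∀ a b → Realised (redirect a b)
  realised-redirect a b = realised-ext (redirect-conjugate a b w)
    (realised-∘ (realised-swap b w) (realised-∘ (realised-redirect-w (swap b w a)) (realised-swap b w)))

  realised-idempotent : ∀ ρ → (∀ j → ρ (ρ j) ≡ ρ j) → Realised ρ
  realised-idempotent ρ idempotent =
    realised-ext (λ j → partial-below (Finₚ.toℕ<n j)) (realised-partial n ℕₚ.≤-refl)
    where
    open IdempotentDecomposition ρ idempotent
    realised-partial : ∀ t → t ≤ n → Realised (partial t)
    realised-partial zero    _   = realised-ext (λ j → sym (partial-above {0} (λ ()))) realised-id
    realised-partial (suc t) t<n = realised-ext (partial-step t<n)
      (realised-∘ (realised-redirect _ _) (realised-partial t (ℕₚ.<⇒≤ t<n)))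

  -- A map A ∈ M sending the value of f on class j to the value of g on p j:
  -- realise the idempotent c ∘ p for a section c of p, then rename values.
  collapse : Σ Map λ A → M A × (∀ j → A (F.value j) ≡ G.value (p j))
  collapse with realised-idempotent (c ∘ p) (λ j → cong c (p∘c (p j)))
             | extend-to-permutation k (F.value ∘ c) G.value (λ i i′ eq → c-injective i i′ (F.value-injective _ _ eq)) G.value-injective
    where
    c : Fin k → Fin n
    c i = proj₁ (p-surjective i)
    p∘c : ∀ i → p (c i) ≡ i
    p∘c i = proj₂ (p-surjective i)
    c-injective : ∀ i i′ → c i ≡ c i′ → i ≡ i′
    c-injective i i′ eq = trans (sym (p∘c i)) (trans (cong p eq) (p∘c i′))
  ... | A , A∈M , A-acts | σ , σ-perm , σ-renames =
    σ ∘ A , M-∘ (M-permutation σ σ-perm) A∈M , λ j → trans (cong σ (A-acts j)) (σ-renames (p j))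

  A : Map
  A = proj₁ collapse

  Placement : ℕ → Fin k → Set
  Placement N i = Σ ℕ λ c → InjectsInto (λ x → G.Class i x × x < N) c × Family (Union p i F.Class) c

  placement : ∀ N i → Placement N i
  placement N i = from-size (κg i) (G.classSize i) (block-size i)
    where
    from-size : ∀ v → HasSize (G.Class i) v → v ≤ω sumClass p i κf → Placement N i
    from-size (fin c) size c≤sum =
      c , injects-weaken (λ _ → proj₁) (finite-injects size) ,
      union-family p i κf F.Class F.classes-disjoint F.classSize c c≤sum
    from-size ω _ ω≤sum =
      N , ((λ x x∈i×x<N → fromℕ< (proj₂ x∈i×x<N)) , below-N-injective) ,
      union-family p i κf F.Class F.classes-disjoint F.classSize N (ω≤sum⇒ (sumClass p i κf) ω≤sum)
      where
      ω≤sum⇒ : ∀ S → ω ≤ω S → fin N ≤ω S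
      ω≤sum⇒ ω _ = tt
      below-N-injective : ∀ x y (px : G.Class i x × x < N) (py : G.Class i y × y < N) →
        fromℕ< (proj₂ px) ≡ fromℕ< (proj₂ py) → x ≡ y
      below-N-injective x y px py eq =
        trans (sym (Finₚ.toℕ-fromℕ< (proj₂ px))) (trans (cong toℕ eq) (Finₚ.toℕ-fromℕ< (proj₂ py)))

  -- On [0, N), g agrees with A ∘ f ∘ π for a permutation π that places each
  -- point into a distinct slot of the block of its g-class.
  module Approximation (N : ℕ) where

    cls : ℕ → Fin k
    cls x = proj₁ (G.classOf x)

    index : ∀ i x → G.Class i x → x < N → Fin (proj₁ (placement N i))
    index i x x∈i x<N = proj₁ (proj₁ (proj₂ (placement N i))) x (x∈i , x<N)

    position : ∀ i → Fin (proj₁ (placement N i)) → ℕ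
    position i = proj₁ (proj₂ (proj₂ (placement N i)))

    position∈ : ∀ i b → Union p i F.Class (position i b)
    position∈ i = proj₂ (proj₂ (proj₂ (proj₂ (placement N i))))

    position-injective : ∀ i i′ → i ≡ i′ → ∀ x y x∈i y∈i′ x<N y<N →
      position i (index i x x∈i x<N) ≡ position i′ (index i′ y y∈i′ y<N) → x ≡ y
    position-injective i .i refl x y x∈i y∈i x<N y<N eq =
      proj₂ (proj₁ (proj₂ (placement N i))) x y _ _
        (proj₁ (proj₂ (proj₂ (proj₂ (placement N i)))) _ _ eq)

    slot : Fin N → ℕ
    slot a = position (cls (toℕ a)) (index _ (toℕ a) (proj₂ (G.classOf (toℕ a))) (Finₚ.toℕ<n a))

    -- Points of different g-classes land in different blocks, hence differ.
    slot-injective : InjectiveFin slot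
    slot-injective a a′ eq with position∈ _ (index _ (toℕ a) _ _) | position∈ _ (index _ (toℕ a′) _ _)
    ... | j , pj≡ , slot∈j | j′ , pj′≡ , slot′∈j′ = Finₚ.toℕ-injective
      (position-injective _ _ (trans (sym pj≡) (trans (cong p j≡j′) pj′≡)) _ _ _ _ _ _ eq)
      where
      j≡j′ : j ≡ j′
      j≡j′ = F.classes-disjoint j j′ (slot a) slot∈j (subst (F.Class j′) (sym eq) slot′∈j′)

    π-spec : Σ Map λ π → IsPermutation π × (∀ a → π (toℕ a) ≡ slot a)
    π-spec = extend-to-permutation N toℕ slot (λ _ _ → Finₚ.toℕ-injective) slot-injective

    π : Map
    π = proj₁ π-spec

    approximation∈M : M (A ∘ f ∘ π)
    approximation∈M = M-∘ (proj₁ (proj₂ collapse)) (M-∘ M-f (M-permutation π (proj₁ (proj₂ π-spec))))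

    agrees-at : ∀ a → A (f (π (toℕ a))) ≡ g (toℕ a)
    agrees-at a with position∈ _ (index _ (toℕ a) (proj₂ (G.classOf (toℕ a))) (Finₚ.toℕ<n a))
    ... | j , pj≡cls , slot∈j = begin
      A (f (π (toℕ a)))  ≡⟨ cong (A ∘ f) (proj₂ (proj₂ π-spec) a) ⟩
      A (f (slot a))     ≡⟨ cong A slot∈j ⟩
      A (F.value j)      ≡⟨ proj₂ (proj₂ collapse) j ⟩
      G.value (p j)      ≡⟨ cong G.value pj≡cls ⟩
      G.value (cls (toℕ a)) ≡⟨ proj₂ (G.classOf (toℕ a)) ⟨
      g (toℕ a)          ∎
      where open ≡-Reasoning

    agrees : ∀ x → x < N → A (f (π x)) ≡ g x
    agrees x x<N = subst (λ z → A (f (π z)) ≡ g z) (Finₚ.toℕ-fromℕ< x<N) (agrees-at (fromℕ< x<N))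

  backward : M g
  backward = M-closed g λ N → A ∘ f ∘ Approximation.π N , Approximation.approximation∈M N , Approximation.agrees N

-- The finite-range hypotheses are implied by the existence of κ^f and κ^g.
lemma20 : (f g : Map) → FiniteRange f → FiniteRange g →
          (n k : ℕ) (κf : Fin n → ℕω) (κg : Fin k → ℕω) →
          IsKappa f n κf → IsKappa g k κg →
          (InGeneratedClosedMonoid f g → κg ⊑ κf) × (κg ⊑ κf → InGeneratedClosedMonoid f g)
lemma20 f g _ _ n k κf κg kf kg =
  Forward.forward kf kg ,
  λ refinement M M-monoid M-closed M-f M-permutation →
    Backward.backward kf kg refinement M M-monoid M-closed M-f M-permutation
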